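{- Let $G$ be a polyhedral embedding on a closed surface with Euler characteristic $\chi\leq 1$, and let $G^*$ be its geometric dual. For any spanning tree $T$ of $G$ there exists an edge-assignment $\tau$ of $G$ with image contained in $E(G)\setminus E(T)$. Moreover, for any such $\tau$, the graph $H_\tau:=G-\{\tau(f): f\in V(G^*)\}$ satisfies (a) $T\subseteq H_\tau$ and (b) $|E(H_\tau)|=|E(T)|-\chi+1$.
   Context: All graphs are simple, undirected and finite. A closed surface is a compact connected 2-manifold without boundary. A graph $G$ embedded in a closed surface is a polyhedral embedding if all facial walks are cycles and any two facial walks are either disjoint or intersect in a single vertex or a single edge. $G^*$ is the geometric dual (vertices are the faces of $G$). An edge-assignment of $G$ is an injective map $\tau:V(G^*)\to E(G)$ such that $\tau(f)$ lies on the boundary of the face $f$ for every $f\in V(G^*)$. $H_\tau$ is obtained from $G$ by deleting the edges $\tau(f)$ (keeping all vertices). -}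

module Defs where

open import Data.Nat using (ℕ; zero; suc; _≤_)
open import Data.Fin using (Fin; inject₁) renaming (suc to fsuc)
import Data.Fin
open import Data.Fin.Properties using (any?; _≟_)
open import Data.Fin.Subset using (Subset; _∈_; _∉_; ∣_∣)
open import Data.Vec using (tabulate)
open import Data.Bool using (not)
open import Data.Integer using (ℤ; +_; _-_; _+_)
open import Data.Product using (Σ; _×_; ∃)
open import Data.Sum using (_⊎_)
open import Function.Definitions using (Injective)
open import Relation.Nullary using (¬_; does)
open import Relation.Binary.PropositionalEquality using (_≡_; _≢_)

-- Cellular embeddings of connected graphs in closed surfaces, encoded
-- combinatorially as (generalised) maps on a finite set of flags
-- Fin N with three fixed-point-free involutions r0, r1, r2 such that
-- r0 r2 = r2 r0 is a fixed-point-free involution, and the group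
-- <r0,r1,r2> acts transitively (connected surface).
-- Vertices = <r1,r2>-orbits, edges = <r0,r2>-orbits,
-- faces = <r0,r1>-orbits.  These orbits are labelled by
-- Fin nV, Fin nE, Fin nF via surjective labelling maps whose fibres are
-- exactly the orbits.

data Reach {N : ℕ} (Step : Fin N → Fin N → Set) : Fin N → Fin N → Set where
  here : ∀ {x} → Reach Step x x
  step : ∀ {x y z} → Step x y → Reach Step y z → Reach Step x z

record Map : Set₁ where
  field
    N nV nE nF : ℕ
    r0 r1 r2 : Fin N → Fin N
    r0-inv : ∀ x → r0 (r0 x) ≡ x
    r1-inv : ∀ x → r1 (r1 x) ≡ x
    r2-inv : ∀ x → r2 (r2 x) ≡ x
    r0-fpf : ∀ x → r0 x ≢ x
    r1-fpf : ∀ x → r1 x ≢ x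
    r2-fpf : ∀ x → r2 x ≢ x
    r02-comm : ∀ x → r0 (r2 x) ≡ r2 (r0 x)
    r02-fpf : ∀ x → r0 (r2 x) ≢ x
    nonempty : Fin N
    connected : ∀ x y →
      Reach (λ a b → b ≡ r0 a ⊎ b ≡ r1 a ⊎ b ≡ r2 a) x y
    vtx : Fin N → Fin nV
    edg : Fin N → Fin nE
    fac : Fin N → Fin nF
    vtx-orbit : ∀ x y → (vtx x ≡ vtx y → Reach (λ a b → b ≡ r1 a ⊎ b ≡ r2 a) x y)
                       × (Reach (λ a b → b ≡ r1 a ⊎ b ≡ r2 a) x y → vtx x ≡ vtx y)
    edg-orbit : ∀ x y → (edg x ≡ edg y → Reach (λ a b → b ≡ r0 a ⊎ b ≡ r2 a) x y)
                       × (Reach (λ a b → b ≡ r0 a ⊎ b ≡ r2 a) x y → edg x ≡ edg y)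
    fac-orbit : ∀ x y → (fac x ≡ fac y → Reach (λ a b → b ≡ r0 a ⊎ b ≡ r1 a) x y)
                       × (Reach (λ a b → b ≡ r0 a ⊎ b ≡ r1 a) x y → fac x ≡ fac y)
    vtx-surj : ∀ v → ∃ λ x → vtx x ≡ v
    edg-surj : ∀ e → ∃ λ x → edg x ≡ e
    fac-surj : ∀ f → ∃ λ x → fac x ≡ f

module _ (M : Map) where
  open Map M

  χ : ℤ
  χ = + nV - + nE + + nF

  Joins : Fin nE → Fin nV → Fin nV → Set
  Joins e u w = ∃ λ x → edg x ≡ e × vtx x ≡ u × vtx (r0 x) ≡ w

  VertexOnFace : Fin nV → Fin nF → Set
  VertexOnFace u f = ∃ λ x → vtx x ≡ u × fac x ≡ f

  EdgeOnFace : Fin nE → Fin nF → Set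
  EdgeOnFace e f = ∃ λ x → edg x ≡ e × fac x ≡ f

  Simple : Set
  Simple = (∀ x → vtx x ≢ vtx (r0 x))
         × (∀ e e' u w → Joins e u w → Joins e' u w → e ≡ e')

  -- Polyhedral embedding: every facial walk is a cycle (no vertex and
  -- no edge is traversed twice), and two distinct faces meet in
  -- nothing, a single vertex, or a single edge (with its ends).
  Polyhedral : Set
  Polyhedral =
      (∀ x y → fac x ≡ fac y → vtx x ≡ vtx y → y ≡ x ⊎ y ≡ r1 x)
    × (∀ x y → fac x ≡ fac y → edg x ≡ edg y → y ≡ x ⊎ y ≡ r0 x)
    × (∀ f g → f ≢ g → ∀ u w → u ≢ w →
         VertexOnFace u f → VertexOnFace u g →
         VertexOnFace w f → VertexOnFace w g →
         (∃ λ e → EdgeOnFace e f × EdgeOnFace e g × Joins e u w)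
         × (∀ t → VertexOnFace t f → VertexOnFace t g → t ≡ u ⊎ t ≡ w))

  data Walk (S : Subset nE) : Fin nV → Fin nV → Set where
    stop : ∀ {u} → Walk S u u
    move : ∀ {u w z} e → e ∈ S → Joins e u w → Walk S w z → Walk S u z

  Cycle : Subset nE → Set
  Cycle S = Σ ℕ λ k → 3 ≤ k × Σ (Fin (suc k) → Fin nV) λ vs →
              Σ (Fin k → Fin nE) λ es →
                vs Fin.zero ≡ vs (Data.Fin.fromℕ k)
              × Injective _≡_ _≡_ (λ i → vs (inject₁ i))
              × Injective _≡_ _≡_ es
              × (∀ i → es i ∈ S × Joins (es i) (vs (inject₁ i)) (vs (fsuc i)))

  SpanningTree : Subset nE → Set
  SpanningTree T = (∀ u w → Walk T u w) × ¬ Cycle T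

  EdgeAssignment : (Fin nF → Fin nE) → Set
  EdgeAssignment τ = Injective _≡_ _≡_ τ × (∀ f → EdgeOnFace (τ f) f)

  Hedges : (Fin nF → Fin nE) → Subset nE
  Hedges τ = tabulate (λ e → not (does (any? (λ f → τ f ≟ e))))

module Submission where

-- Let T be a spanning tree of G and C = E(G) ∖ T its complement. Then C is connected
-- as an edge set of the dual G*: otherwise some set S of faces is closed under C-edges
-- without containing every face, and the edges separating S from the other faces all
-- lie in T. A deepest tree vertex v whose parent edge separates S has no other such
-- edge, so exactly one flag at v lies on a face of S while its r2-neighbour does not.
-- This is impossible: the flags at v on faces of S are paired by r1, and all but that
-- one are also paired by r2.
-- Euler's formula with χ ≤ 1 and |T| = |V| − 1 gives |C| ≥ |F|, so a spanning tree of
-- (F, C) misses an edge e₀ of C. Take a spanning tree of (F, C − e₀) rooted at a face a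
-- of e₀, and assign e₀ to a and to every other face the edge to its parent.
-- For any edge-assignment τ avoiding T, clearly T ⊆ H_τ, and since τ is injective,
-- |E(H_τ)| = |E| − |F| = |T| − χ + 1.

open import Defs
open import Data.Nat using (ℕ)
open import Data.Fin using (Fin)
open import Data.Fin.Subset using (Subset; _∈_; _∉_; ∣_∣)
open import Data.Product using (Σ; _×_; _,_)
open import Relation.Binary.PropositionalEquality using (_≡_)

module Counting where
  open import Data.Nat using (suc; _+_; _≤_; _*_; s≤s; z≤n)
  open import Data.Nat.Properties using (≤-trans; *-suc; m+[n∸m]≡n)
  open import Data.Fin.Properties using (suc-injective)
  open import Data.Fin.Subset using (inside; outside; ∁; _-_; _─_; ⁅_⁆; _⊂_)
  open import Data.Fin.Subset.Properties
    using (∣∁p∣≡n∸∣p∣; ∣p∣≤n; p─q⊆p; p─⊥≡p; x∈p∧x≢y⇒x∈p-y; x∈⁅x⁆; x∈p⇒∣p-x∣<∣p∣; x∈p⇒p-x⊂p;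
           ⊂-trans; nonempty?; Empty-unique; ∣⊥∣≡0)
  open import Data.Fin.Subset.Induction using (⊂-wellFounded; Acc; acc)
  open import Data.Vec using (_∷_; []; tabulate; here; there)
  open import Data.Vec.Properties using (lookup∘tabulate; []=⇒lookup; lookup⇒[]=)
  open import Data.Product using (∃)
  open import Data.List using (allFin; filter)
  open import Data.List.Extrema.Nat using (argmax; argmax-all; f[xs]≤f[argmax])
  open import Data.List.Relation.Unary.All as All using ()
  open import Data.List.Relation.Unary.All.Properties using (all-filter)
  open import Data.List.Membership.Propositional.Properties using (∈-filter⁺; ∈-allFin)
  open import Function using (_∘_; case_of_)
  open import Level using (Level)
  open import Relation.Nullary using (yes; no; does)
  open import Relation.Nullary.Decidable using (dec-true)
  open import Relation.Unary using (Pred; Decidable)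
  open import Relation.Binary.PropositionalEquality using (_≢_; refl; sym; trans; cong; module ≡-Reasoning)

  private variable
    ℓ : Level
    n : ℕ
    p q : Subset n
    x y : Fin n

  x∈p─q⇒x∉q : ∀ (p q : Subset n) → x ∈ p ─ q → x ∉ q
  x∈p─q⇒x∉q (_ ∷ p) (_ ∷ q) (there x∈p─q) (there x∈q) = x∈p─q⇒x∉q p q x∈p─q x∈q

  x∈p-y⇒x≢y : x ∈ p - y → x ≢ y
  x∈p-y⇒x≢y {p = p} {y = y} x∈p-y refl = x∈p─q⇒x∉q p ⁅ y ⁆ x∈p-y (x∈⁅x⁆ y)

  ∣p∣≡1+∣p-x∣ : x ∈ p → ∣ p ∣ ≡ suc ∣ p - x ∣
  ∣p∣≡1+∣p-x∣ {p = inside ∷ p}  here        = cong suc (sym (cong ∣_∣ (p─⊥≡p p)))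
  ∣p∣≡1+∣p-x∣ {p = inside ∷ p}  (there x∈p) = cong suc (∣p∣≡1+∣p-x∣ x∈p)
  ∣p∣≡1+∣p-x∣ {p = outside ∷ p} (there x∈p) = ∣p∣≡1+∣p-x∣ x∈p

  ∣p∣+∣∁p∣≡n : ∀ (p : Subset n) → ∣ p ∣ + ∣ ∁ p ∣ ≡ n
  ∣p∣+∣∁p∣≡n p = trans (cong (∣ p ∣ +_) (∣∁p∣≡n∸∣p∣ p)) (m+[n∸m]≡n (∣p∣≤n p))

  injection⇒∣p∣≤∣q∣ : {m : ℕ} {p : Subset m} (f : ∀ {x} → x ∈ p → Fin n) →
    (∀ {x} (x∈p : x ∈ p) → f x∈p ∈ q) →
    (∀ {x y} (x∈p : x ∈ p) (y∈p : y ∈ p) → f x∈p ≡ f y∈p → x ≡ y) →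
    ∣ p ∣ ≤ ∣ q ∣
  injection⇒∣p∣≤∣q∣ {p = []} _ _ _ = z≤n
  injection⇒∣p∣≤∣q∣ {p = outside ∷ p} f f∈q f-injective =
    injection⇒∣p∣≤∣q∣ (λ x∈p → f (there x∈p)) (λ x∈p → f∈q (there x∈p))
      (λ x∈p y∈p same → suc-injective (f-injective (there x∈p) (there y∈p) same))
  injection⇒∣p∣≤∣q∣ {q = q} {p = inside ∷ p} f f∈q f-injective = ≤-trans
    (s≤s (injection⇒∣p∣≤∣q∣ (λ x∈p → f (there x∈p)) f∈q-f₀
      (λ x∈p y∈p same → suc-injective (f-injective (there x∈p) (there y∈p) same))))
    (x∈p⇒∣p-x∣<∣p∣ (f∈q here))
    where
    f∈q-f₀ : ∀ {x} (x∈p : x ∈ p) → f (there x∈p) ∈ q - f here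
    f∈q-f₀ x∈p = x∈p∧x≢y⇒x∈p-y (f∈q (there x∈p))
      λ same → case f-injective (there x∈p) here same of λ ()

  module _ {σ : Fin n → Fin n}
           (σ-involutive : ∀ x → σ (σ x) ≡ x) (σ-fixed-point-free : ∀ x → σ x ≢ x) where

    σ-closed⇒∣p∣-even : (∀ {x} → x ∈ p → σ x ∈ p) → ∃ λ k → ∣ p ∣ ≡ 2 * k
    σ-closed⇒∣p∣-even {p} = go (⊂-wellFounded p)
      where
      go : ∀ {p} → Acc _⊂_ p → (∀ {x} → x ∈ p → σ x ∈ p) → ∃ λ k → ∣ p ∣ ≡ 2 * k
      go {p} (acc smaller) closed with nonempty? p
      ... | no empty = 0 , trans (cong ∣_∣ (Empty-unique empty)) (∣⊥∣≡0 n)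
      ... | yes (x , x∈p) =
        let k , ∣p′∣≡2k = go (smaller (⊂-trans (x∈p⇒p-x⊂p σx∈p-x) (x∈p⇒p-x⊂p x∈p))) closed′
        in suc k , (begin
          ∣ p ∣                     ≡⟨ ∣p∣≡1+∣p-x∣ x∈p ⟩
          suc ∣ p - x ∣             ≡⟨ cong suc (∣p∣≡1+∣p-x∣ σx∈p-x) ⟩
          suc (suc ∣ p - x - σ x ∣) ≡⟨ cong (2 +_) ∣p′∣≡2k ⟩
          suc (suc (2 * k))         ≡⟨ sym (*-suc 2 k) ⟩
          2 * suc k                 ∎)
        where
        open ≡-Reasoning
        σx∈p-x : σ x ∈ p - x
        σx∈p-x = x∈p∧x≢y⇒x∈p-y (closed x∈p) (σ-fixed-point-free x)

        closed′ : ∀ {z} → z ∈ p - x - σ x → σ z ∈ p - x - σ x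
        closed′ {z} z∈p′ = x∈p∧x≢y⇒x∈p-y (x∈p∧x≢y⇒x∈p-y (closed z∈p) σz≢x) σz≢σx
          where
          z∈p-x = p─q⊆p _ _ z∈p′
          z∈p = p─q⊆p _ _ z∈p-x
          σz≢x : σ z ≢ x
          σz≢x σz≡x = x∈p-y⇒x≢y z∈p′ (trans (sym (σ-involutive z)) (cong σ σz≡x))
          σz≢σx : σ z ≢ σ x
          σz≢σx σz≡σx =
            x∈p-y⇒x≢y z∈p-x (trans (sym (σ-involutive z)) (trans (cong σ σz≡σx) (σ-involutive x)))

  ∃-argmax : {P : Pred (Fin n) ℓ} → Decidable P → (w : Fin n → ℕ) → P x →
    ∃ λ y → P y × (∀ {z} → P z → w z ≤ w y)
  ∃-argmax {n} {x = x} P? w Px =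
    argmax w x candidates ,
    argmax-all w Px (all-filter P? (allFin n)) ,
    λ Pz → All.lookup (f[xs]≤f[argmax] {f = w} x candidates) (∈-filter⁺ P? (∈-allFin _) Pz)
    where
    candidates = filter P? (allFin n)

  toSubset : {P : Pred (Fin n) ℓ} → Decidable P → Subset n
  toSubset P? = tabulate (does ∘ P?)

  module _ {P : Pred (Fin n) ℓ} (P? : Decidable P) where

    ∈-toSubset⁺ : P x → x ∈ toSubset P?
    ∈-toSubset⁺ {x} Px = lookup⇒[]= x _ (trans (lookup∘tabulate _ x) (dec-true (P? x) Px))

    ∈-toSubset⁻ : x ∈ toSubset P? → P x
    ∈-toSubset⁻ {x} x∈ with P? x | trans (sym (lookup∘tabulate (does ∘ P?) x)) ([]=⇒lookup x∈)
    ... | yes Px | _ = Px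

open Counting

module Graph {n m : ℕ} (Adj : Fin m → Fin n → Fin n → Set) where
  open import Data.Nat using (suc; _≤_; _<_; s≤s)
  open import Data.Nat.Properties using (≤-refl; ≤-pred; <-≤-trans; <-asym; <⇒≱; module ≤-Reasoning)
  open import Data.Fin.Properties using (_≟_; any?)
  open import Data.Fin.Subset using (_-_; _∪_; ⁅_⁆; ⊤; _⊃_)
  open import Data.Fin.Subset.Properties
    using (_∈?_; x∈p∧x≢y⇒x∈p-y; ∈⊤; ∣⊤∣≡n; x∈p∪q⁺; x∈p∪q⁻; x∈⁅x⁆; x∈⁅y⁆⇒x≡y; p⊆p∪q)
  open import Data.Fin.Subset.Induction using (⊃-wellFounded; Acc; acc)
  open import Data.Empty using (⊥-elim; ⊥-elim-irr)
  open import Data.Product using (∃; proj₁; proj₂)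
  open import Data.Sum using (_⊎_; inj₁; inj₂)
  open import Function using (id)
  open import Function.Definitions using (Injective)
  open import Level using (Level)
  open import Relation.Nullary using (Dec; yes; no; ¬_)
  open import Relation.Nullary.Decidable using (map′; _×-dec_; ¬?)
  open import Relation.Unary using (Pred; Decidable)
  open import Relation.Binary.PropositionalEquality using (_≢_; refl; sym; trans; subst; subst₂)

  private variable
    ℓ : Level

  Undirected : Set
  Undirected = ∀ {e a b} → Adj e a b → Adj e b a

  EndsDetermined : Set
  EndsDetermined = ∀ {e a b c d} → Adj e a b → Adj e c d → (a ≡ c × b ≡ d) ⊎ (a ≡ d × b ≡ c)

  Closed : Subset m → Subset n → Set
  Closed K X = ∀ {e a b} → e ∈ K → Adj e a b → a ∈ X → b ∈ X

  Connected : Subset m → Fin n → Set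
  Connected K r = ∀ {X} → Closed K X → r ∈ X → ∀ v → v ∈ X

  record Parent (K : Subset m) (depth : Fin n → ℕ) (v : Fin n) : Set where
    field
      up        : Fin n
      upEdge    : Fin m
      upEdge∈K  : upEdge ∈ K
      adjacent  : Adj upEdge up v
      shallower : depth up < depth v

  -- Only non-root vertices have a parent; as the proof of v ≢ r is irrelevant,
  -- parent v does not depend on it.
  record Arborescence (K : Subset m) (r : Fin n) : Set where
    field
      depth  : Fin n → ℕ
      parent : ∀ v → .(v ≢ r) → Parent K depth v

    up : ∀ v → .(v ≢ r) → Fin n
    up v v≢r = Parent.up (parent v v≢r)

    upEdge : ∀ v → .(v ≢ r) → Fin m
    upEdge v v≢r = Parent.upEdge (parent v v≢r)

    upEdge∈K : ∀ {v} .(v≢r : v ≢ r) → upEdge v v≢r ∈ K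
    upEdge∈K {v} v≢r = Parent.upEdge∈K (parent v v≢r)

    upEdge-adjacent : ∀ {v} .(v≢r : v ≢ r) → Adj (upEdge v v≢r) (up v v≢r) v
    upEdge-adjacent {v} v≢r = Parent.adjacent (parent v v≢r)

    up-shallower : ∀ {v} .(v≢r : v ≢ r) → depth (up v v≢r) < depth v
    up-shallower {v} v≢r = Parent.shallower (parent v v≢r)

    IsUpEdge : Fin m → Set
    IsUpEdge e = ∃ λ v → Σ (v ≢ r) λ v≢r → upEdge v v≢r ≡ e

    isUpEdge? : Decidable IsUpEdge
    isUpEdge? e = any? upEdge-of?
      where
      upEdge-of? : ∀ v → Dec (Σ (v ≢ r) λ v≢r → upEdge v v≢r ≡ e)
      upEdge-of? v with v ≟ r
      ... | yes refl = no λ (r≢r , _) → r≢r refl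
      ... | no v≢r = map′ (v≢r ,_) proj₂ (upEdge v v≢r ≟ e)

    induction : (P : Fin n → Set ℓ) → P r → (∀ {v} (v≢r : v ≢ r) → P (up v v≢r) → P v) → ∀ v → P v
    induction P Pr inherit v = go (suc (depth v)) v ≤-refl
      where
      go : ∀ k v → depth v < k → P v
      go (suc k) v depth<k with v ≟ r
      ... | yes refl = Pr
      ... | no v≢r = inherit v≢r (go k _ (<-≤-trans (up-shallower v≢r) (≤-pred depth<k)))

    upEdge-injective : EndsDetermined → ∀ {v w} (v≢r : v ≢ r) (w≢r : w ≢ r) →
      upEdge v v≢r ≡ upEdge w w≢r → v ≡ w
    upEdge-injective ends {v} {w} v≢r w≢r same
      with ends (upEdge-adjacent v≢r) (subst (λ e → Adj e (up w w≢r) w) (sym same) (upEdge-adjacent w≢r))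
    ... | inj₁ (_ , v≡w) = v≡w
    ... | inj₂ (up-v≡w , v≡up-w) = ⊥-elim (<-asym
          (subst (λ u → depth u < depth v) up-v≡w (up-shallower v≢r))
          (subst (λ u → depth u < depth w) (sym v≡up-w) (up-shallower w≢r)))

    n≡1+∣⊤-r∣ : n ≡ suc ∣ ⊤ - r ∣
    n≡1+∣⊤-r∣ = trans (sym (∣⊤∣≡n n)) (∣p∣≡1+∣p-x∣ (∈⊤ {x = r}))

    n≤1+∣K∣ : EndsDetermined → n ≤ suc ∣ K ∣
    n≤1+∣K∣ ends = begin
      n             ≡⟨ n≡1+∣⊤-r∣ ⟩
      suc ∣ ⊤ - r ∣ ≤⟨ s≤s (injection⇒∣p∣≤∣q∣ {p = ⊤ - r} (λ {v} v∈ → upEdge v (x∈p-y⇒x≢y v∈))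
                              (λ v∈ → upEdge∈K (x∈p-y⇒x≢y v∈))
                              (λ v∈ w∈ → upEdge-injective ends (x∈p-y⇒x≢y v∈) (x∈p-y⇒x≢y w∈))) ⟩
      suc ∣ K ∣     ∎
      where open ≤-Reasoning

    up-edges-onto⇒∣K∣<n : (∀ {e} → e ∈ K → IsUpEdge e) → ∣ K ∣ < n
    up-edges-onto⇒∣K∣<n onto = begin-strict
      ∣ K ∣         ≤⟨ injection⇒∣p∣≤∣q∣ {q = ⊤ - r} (λ e∈K → proj₁ (onto e∈K))
                         (λ e∈K → x∈p∧x≢y⇒x∈p-y (∈⊤ {n}) (proj₁ (proj₂ (onto e∈K)))) same-child ⟩
      ∣ ⊤ - r ∣     <⟨ s≤s ≤-refl ⟩
      suc ∣ ⊤ - r ∣ ≡⟨ sym n≡1+∣⊤-r∣ ⟩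
      n             ∎
      where
      open ≤-Reasoning
      same-child : ∀ {e e′} (e∈K : e ∈ K) (e′∈K : e′ ∈ K) →
        proj₁ (onto e∈K) ≡ proj₁ (onto e′∈K) → e ≡ e′
      same-child e∈K e′∈K same with onto e∈K | onto e′∈K
      ... | _ , _ , refl | _ , _ , refl with refl ← same = refl

    -- Take v deepest among the vertices whose parent edge is in B: any other B-edge at v
    -- would be the parent edge of a child of v, which is deeper.
    leaf : EndsDetermined → (∀ {e} → e ∈ K → IsUpEdge e) →
      {B : Pred (Fin m) ℓ} → Decidable B → (∀ {e} → B e → e ∈ K) → ∀ {e} → B e →
      ∃ λ v → Σ (v ≢ r) λ v≢r → B (upEdge v v≢r) × (∀ {e w} → B e → Adj e v w → e ≡ upEdge v v≢r)
    leaf ends onto {B = B} B? B⊆K Be₀ = v , v≢r , Bv , only-B-edge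
      where
      Candidate : Fin n → Set _
      Candidate v = Σ (v ≢ r) λ v≢r → B (upEdge v v≢r)

      candidate? : Decidable Candidate
      candidate? v with v ≟ r
      ... | yes refl = no λ (r≢r , _) → r≢r refl
      ... | no v≢r = map′ (v≢r ,_) proj₂ (B? (upEdge v v≢r))

      some-candidate : ∃ Candidate
      some-candidate with onto (B⊆K Be₀)
      ... | c , c≢r , refl = c , c≢r , Be₀

      deepest : ∃ λ v → Candidate v × (∀ {w} → Candidate w → depth w ≤ depth v)
      deepest = ∃-argmax candidate? depth (proj₂ some-candidate)

      v = proj₁ deepest
      v≢r = proj₁ (proj₁ (proj₂ deepest))
      Bv = proj₂ (proj₁ (proj₂ deepest))

      only-B-edge : ∀ {e w} → B e → Adj e v w → e ≡ upEdge v v≢r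
      only-B-edge Be v-w with onto (B⊆K Be)
      ... | c , c≢r , refl with ends (upEdge-adjacent c≢r) v-w
      ...   | inj₂ (_ , refl) = refl
      ...   | inj₁ (up-c≡v , _) = ⊥-elim (<⇒≱
              (subst (λ u → depth u < depth c) up-c≡v (up-shallower c≢r))
              (proj₂ (proj₂ deepest) (c≢r , Be)))

    connects : Undirected → ∀ a → Connected K a
    connects undirected a {X} closed a∈X =
      induction (_∈ X) r∈X λ v≢r up∈X → closed (upEdge∈K v≢r) (upEdge-adjacent v≢r) up∈X
      where
      r∈X : r ∈ X
      r∈X = induction (λ v → v ∈ X → r ∈ X) id
        (λ v≢r ih v∈X → ih (closed (upEdge∈K v≢r) (undirected (upEdge-adjacent v≢r)) v∈X))
        a a∈X

    narrow : ∀ {K′} → (∀ {v} (v≢r : v ≢ r) → upEdge v v≢r ∈ K′) → Arborescence K′ r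
    narrow {K′} ⊆K′ = record { depth = depth ; parent = parent′ }
      where
      parent′ : ∀ v → .(v ≢ r) → Parent K′ depth v
      parent′ v v≢r with v ≟ r
      ... | yes refl = ⊥-elim-irr (v≢r refl)
      ... | no v≢r′ = record { Parent (parent v v≢r′) ; upEdge∈K = ⊆K′ v≢r′ }

    assignment : EndsDetermined → ∀ {e₀} → e₀ ∉ K → (∃ λ u → Adj e₀ u r) →
      Σ (Fin n → Fin m) λ τ →
        Injective _≡_ _≡_ τ × (∀ v → ∃ λ u → Adj (τ v) u v) × (∀ v → τ v ≡ e₀ ⊎ τ v ∈ K)
    assignment ends {e₀} e₀∉K e₀-at-r = τ , τ-injective , τ-incident , τ-new-or-tree
      where
      τ : Fin n → Fin m
      τ v with v ≟ r
      ... | yes _ = e₀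
      ... | no v≢r = upEdge v v≢r

      τ-injective : Injective _≡_ _≡_ τ
      τ-injective {v} {w} same with v ≟ r | w ≟ r
      ... | yes refl | yes refl = refl
      ... | yes _    | no w≢r   = ⊥-elim (e₀∉K (subst (_∈ K) (sym same) (upEdge∈K w≢r)))
      ... | no v≢r   | yes _    = ⊥-elim (e₀∉K (subst (_∈ K) same (upEdge∈K v≢r)))
      ... | no v≢r   | no w≢r   = upEdge-injective ends v≢r w≢r same

      τ-incident : ∀ v → ∃ λ u → Adj (τ v) u v
      τ-incident v with v ≟ r
      ... | yes refl = e₀-at-r
      ... | no v≢r = up v v≢r , upEdge-adjacent v≢r

      τ-new-or-tree : ∀ v → τ v ≡ e₀ ⊎ τ v ∈ K
      τ-new-or-tree v with v ≟ r
      ... | yes _ = inj₁ refl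
      ... | no v≢r = inj₂ (upEdge∈K v≢r)

  record PartialArborescence (K : Subset m) (r : Fin n) (X : Subset n) : Set where
    field
      root∈  : r ∈ X
      depth  : Fin n → ℕ
      parent : ∀ {v} → v ∈ X → .(v ≢ r) → Σ (Parent K depth v) λ p → Parent.up p ∈ X

  module Growth (adj? : ∀ e a b → Dec (Adj e a b)) (K : Subset m) (r : Fin n) where

    singleton : PartialArborescence K r ⁅ r ⁆
    singleton = record
      { root∈  = x∈⁅x⁆ r
      ; depth  = λ _ → 0
      ; parent = λ v∈⁅r⁆ v≢r → ⊥-elim-irr (v≢r (x∈⁅y⁆⇒x≡y r v∈⁅r⁆))
      }

    module Extension {X a b e} (A : PartialArborescence K r X)
                     (b∉X : b ∉ X) (a∈X : a ∈ X) (e∈K : e ∈ K) (a-b : Adj e a b) where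
      open PartialArborescence A

      depth′ : Fin n → ℕ
      depth′ v with v ≟ b
      ... | yes _ = suc (depth a)
      ... | no _ = depth v

      depth′-old : ∀ {v} → v ∈ X → depth′ v ≡ depth v
      depth′-old {v} v∈X with v ≟ b
      ... | yes refl = ⊥-elim (b∉X v∈X)
      ... | no _ = refl

      depth′-new : depth′ b ≡ suc (depth a)
      depth′-new with b ≟ b
      ... | yes _ = refl
      ... | no b≢b = ⊥-elim (b≢b refl)

      old∈ : ∀ {v} → v ∈ X → v ∈ X ∪ ⁅ b ⁆
      old∈ v∈X = x∈p∪q⁺ (inj₁ v∈X)

      parent′ : ∀ {v} → v ∈ X ∪ ⁅ b ⁆ → .(v ≢ r) → Σ (Parent K depth′ v) λ p → Parent.up p ∈ X ∪ ⁅ b ⁆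
      parent′ {v} v∈X∪b v≢r with v ≟ b | x∈p∪q⁻ X ⁅ b ⁆ v∈X∪b
      ... | yes refl | _ = record
            { up = a ; upEdge = e ; upEdge∈K = e∈K ; adjacent = a-b
            ; shallower = subst₂ _<_ (sym (depth′-old a∈X)) (sym depth′-new) ≤-refl
            } , old∈ a∈X
      ... | no v≢b | inj₂ v∈⁅b⁆ = ⊥-elim (v≢b (x∈⁅y⁆⇒x≡y b v∈⁅b⁆))
      ... | no _   | inj₁ v∈X = record
            { Parent p
            ; shallower = subst₂ _<_ (sym (depth′-old up∈X)) (sym (depth′-old v∈X)) (Parent.shallower p)
            } , old∈ up∈X
        where
        p = proj₁ (parent v∈X v≢r)
        up∈X = proj₂ (parent v∈X v≢r)

      extend : PartialArborescence K r (X ∪ ⁅ b ⁆)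
      extend = record { root∈ = old∈ root∈ ; depth = depth′ ; parent = parent′ }

    Crossing : Subset n → Set
    Crossing X = ∃ λ b → b ∉ X × ∃ λ a → a ∈ X × ∃ λ e → e ∈ K × Adj e a b

    crossing? : ∀ X → Dec (Crossing X)
    crossing? X =
      any? λ b → ¬? (b ∈? X) ×-dec any? λ a → a ∈? X ×-dec any? λ e → e ∈? K ×-dec adj? e a b

    no-crossing⇒closed : ∀ {X} → ¬ Crossing X → Closed K X
    no-crossing⇒closed {X} no-crossing {e} {a} {b} e∈K a-b a∈X with b ∈? X
    ... | yes b∈X = b∈X
    ... | no b∉X = ⊥-elim (no-crossing (b , b∉X , a , a∈X , e , e∈K , a-b))

    grow : ∃ λ X → Closed K X × PartialArborescence K r X
    grow = go (⊃-wellFounded ⁅ r ⁆) singleton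
      where
      go : ∀ {X} → Acc _⊃_ X → PartialArborescence K r X → ∃ λ X → Closed K X × PartialArborescence K r X
      go {X} (acc larger) A with crossing? X
      ... | no no-crossing = X , no-crossing⇒closed no-crossing , A
      ... | yes (b , b∉X , a , a∈X , e , e∈K , a-b) =
            go (larger (p⊆p∪q ⁅ b ⁆ , b , x∈p∪q⁺ (inj₂ (x∈⁅x⁆ b)) , b∉X))
               (Extension.extend A b∉X a∈X e∈K a-b)

  spanning-arborescence : (∀ e a b → Dec (Adj e a b)) → ∀ {K r} → Connected K r → Arborescence K r
  spanning-arborescence adj? {K} {r} K-connected = record
    { depth  = depth
    ; parent = λ v v≢r → proj₁ (parent (K-connected closed root∈ v) v≢r)
    }
    where
    open Growth adj? K r
    closed = proj₁ (proj₂ grow)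
    open PartialArborescence (proj₂ (proj₂ grow))

module MapProperties (M : Map) where
  open Map M
  open import Data.Nat using (suc; _*_)
  open import Data.Nat.Properties using (even≢odd)
  open import Data.Fin.Properties using (_≟_; any?)
  open import Data.Fin.Subset using (_-_)
  open import Data.Fin.Subset.Properties using (_∈?_; x∈p∧x≢y⇒x∈p-y; p─q⊆p)
  open import Data.Empty using (⊥-elim)
  open import Data.Product using (∃; _,_; proj₁; proj₂)
  open import Data.Sum using (_⊎_; inj₁; inj₂)
  open import Relation.Nullary using (Dec; yes; no; ¬_)
  open import Relation.Nullary.Decidable using (_×-dec_; ¬?)
  open import Relation.Binary.PropositionalEquality using (_≢_; refl; sym; trans; cong; subst; module ≡-Reasoning)

  vtx-r1 : ∀ x → vtx (r1 x) ≡ vtx x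
  vtx-r1 x = sym (proj₂ (vtx-orbit x (r1 x)) (step (inj₁ refl) here))

  vtx-r2 : ∀ x → vtx (r2 x) ≡ vtx x
  vtx-r2 x = sym (proj₂ (vtx-orbit x (r2 x)) (step (inj₂ refl) here))

  edg-r0 : ∀ x → edg (r0 x) ≡ edg x
  edg-r0 x = sym (proj₂ (edg-orbit x (r0 x)) (step (inj₁ refl) here))

  edg-r2 : ∀ x → edg (r2 x) ≡ edg x
  edg-r2 x = sym (proj₂ (edg-orbit x (r2 x)) (step (inj₂ refl) here))

  fac-r0 : ∀ x → fac (r0 x) ≡ fac x
  fac-r0 x = sym (proj₂ (fac-orbit x (r0 x)) (step (inj₁ refl) here))

  fac-r1 : ∀ x → fac (r1 x) ≡ fac x
  fac-r1 x = sym (proj₂ (fac-orbit x (r1 x)) (step (inj₂ refl) here))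

  EdgeOrbit : Fin N → Fin N → Set
  EdgeOrbit x y = y ≡ x ⊎ y ≡ r0 x ⊎ y ≡ r2 x ⊎ y ≡ r0 (r2 x)

  edge-orbit : ∀ {x y} → edg x ≡ edg y → EdgeOrbit x y
  edge-orbit {x} same = along (proj₁ (edg-orbit x _) same) (inj₁ refl)
    where
    next : ∀ {y z} → EdgeOrbit x y → z ≡ r0 y ⊎ z ≡ r2 y → EdgeOrbit x z
    next (inj₁ refl)               (inj₁ refl) = inj₂ (inj₁ refl)
    next (inj₁ refl)               (inj₂ refl) = inj₂ (inj₂ (inj₁ refl))
    next (inj₂ (inj₁ refl))        (inj₁ refl) = inj₁ (r0-inv x)
    next (inj₂ (inj₁ refl))        (inj₂ refl) = inj₂ (inj₂ (inj₂ (sym (r02-comm x))))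
    next (inj₂ (inj₂ (inj₁ refl))) (inj₁ refl) = inj₂ (inj₂ (inj₂ refl))
    next (inj₂ (inj₂ (inj₁ refl))) (inj₂ refl) = inj₁ (r2-inv x)
    next (inj₂ (inj₂ (inj₂ refl))) (inj₁ refl) = inj₂ (inj₂ (inj₁ (r0-inv (r2 x))))
    next (inj₂ (inj₂ (inj₂ refl))) (inj₂ refl) =
      inj₂ (inj₁ (trans (sym (r02-comm (r2 x))) (cong r0 (r2-inv x))))

    along : ∀ {y z} → Reach (λ a b → b ≡ r0 a ⊎ b ≡ r2 a) y z → EdgeOrbit x y → EdgeOrbit x z
    along here            in-orbit = in-orbit
    along (step s y⇝z)    in-orbit = along y⇝z (next in-orbit s)

  -- Link r0 r2 vtx is the adjacency Joins M of G, and Link r2 r0 fac that of its dual.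
  module Link {k : ℕ} (ρ ρ′ : Fin N → Fin N) (lab : Fin N → Fin k)
              (ρ-involutive : ∀ x → ρ (ρ x) ≡ x) (edg-ρ : ∀ x → edg (ρ x) ≡ edg x)
              (lab-ρ′ : ∀ x → lab (ρ′ x) ≡ lab x) (ρρ′≡ρ′ρ : ∀ x → ρ (ρ′ x) ≡ ρ′ (ρ x))
              (orbit : ∀ {x y} → edg x ≡ edg y → y ≡ x ⊎ y ≡ ρ x ⊎ y ≡ ρ′ x ⊎ y ≡ ρ (ρ′ x)) where

    Link : Fin nE → Fin k → Fin k → Set
    Link e a b = ∃ λ x → edg x ≡ e × lab x ≡ a × lab (ρ x) ≡ b

    open Graph Link using (Undirected; EndsDetermined)

    link-undirected : Undirected
    link-undirected (x , refl , refl , refl) = ρ x , edg-ρ x , refl , cong lab (ρ-involutive x)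

    link? : ∀ e a b → Dec (Link e a b)
    link? e a b = any? λ x → edg x ≟ e ×-dec lab x ≟ a ×-dec lab (ρ x) ≟ b

    lab-ρρ′ : ∀ x → lab (ρ (ρ′ x)) ≡ lab (ρ x)
    lab-ρρ′ x = trans (cong lab (ρρ′≡ρ′ρ x)) (lab-ρ′ (ρ x))

    link-ends : EndsDetermined
    link-ends (x , refl , refl , refl) (y , same , refl , refl) with orbit (sym same)
    ... | inj₁ refl                = inj₁ (refl , refl)
    ... | inj₂ (inj₁ refl)         = inj₂ (sym (cong lab (ρ-involutive x)) , refl)
    ... | inj₂ (inj₂ (inj₁ refl))  = inj₁ (sym (lab-ρ′ x) , sym (lab-ρρ′ x))
    ... | inj₂ (inj₂ (inj₂ refl))  =
          inj₂ (sym (trans (cong lab (ρ-involutive (ρ′ x))) (lab-ρ′ x)) , sym (lab-ρρ′ x))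

  dual-edge-orbit : ∀ {x y} → edg x ≡ edg y → y ≡ x ⊎ y ≡ r2 x ⊎ y ≡ r0 x ⊎ y ≡ r2 (r0 x)
  dual-edge-orbit same with edge-orbit same
  ... | inj₁ y≡x                = inj₁ y≡x
  ... | inj₂ (inj₁ y≡r0x)       = inj₂ (inj₂ (inj₁ y≡r0x))
  ... | inj₂ (inj₂ (inj₁ y≡r2x)) = inj₂ (inj₁ y≡r2x)
  ... | inj₂ (inj₂ (inj₂ refl)) = inj₂ (inj₂ (inj₂ (r02-comm _)))

  module Primal = Link r0 r2 vtx r0-inv edg-r0 vtx-r2 r02-comm edge-orbit
  module Dual = Link r2 r0 fac r2-inv edg-r2 fac-r0 (λ x → sym (r02-comm x)) dual-edge-orbit

  DualJoins : Fin nE → Fin nF → Fin nF → Set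
  DualJoins = Dual.Link

  dual-incident⇒on-face : ∀ {e f} → (∃ λ g → DualJoins e g f) → EdgeOnFace M e f
  dual-incident⇒on-face (_ , x , x-edge , _ , r2x-face) = r2 x , trans (edg-r2 x) x-edge , r2x-face

  same-vertex-and-edge : (∀ x → vtx x ≢ vtx (r0 x)) → ∀ {y z} →
    edg y ≡ edg z → vtx z ≡ vtx y → z ≡ y ⊎ z ≡ r2 y
  same-vertex-and-edge loopless {y} same same-vtx with edge-orbit same
  ... | inj₁ z≡y                = inj₁ z≡y
  ... | inj₂ (inj₁ refl)        = ⊥-elim (loopless y (sym same-vtx))
  ... | inj₂ (inj₂ (inj₁ z≡r2y)) = inj₂ z≡r2y
  ... | inj₂ (inj₂ (inj₂ refl)) =
        ⊥-elim (loopless y (sym (trans (sym (trans (cong vtx (r02-comm y)) (vtx-r2 (r0 y)))) same-vtx)))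

  crossing : (S : Subset nF) → ∀ {x y} → Reach (λ a b → b ≡ r0 a ⊎ b ≡ r1 a ⊎ b ≡ r2 a) x y →
    fac x ∈ S → fac y ∉ S → ∃ λ z → fac z ∈ S × fac (r2 z) ∉ S
  crossing S here x∈S y∉S = ⊥-elim (y∉S x∈S)
  crossing S (step {y = x′} x→x′ x′⇝y) x∈S y∉S with fac x′ ∈? S
  ... | yes x′∈S = crossing S x′⇝y x′∈S y∉S
  ... | no x′∉S with x→x′
  ...   | inj₁ refl        = ⊥-elim (x′∉S (subst (_∈ S) (sym (fac-r0 _)) x∈S))
  ...   | inj₂ (inj₁ refl) = ⊥-elim (x′∉S (subst (_∈ S) (sym (fac-r1 _)) x∈S))
  ...   | inj₂ (inj₂ refl) = _ , x∈S , x′∉S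

  Boundary : Subset nF → Fin nE → Set
  Boundary S e = ∃ λ z → edg z ≡ e × fac z ∈ S × fac (r2 z) ∉ S

  boundary? : ∀ S e → Dec (Boundary S e)
  boundary? S e = any? λ z → edg z ≟ e ×-dec fac z ∈? S ×-dec ¬? (fac (r2 z) ∈? S)

  boundary-flag-at : ∀ {S e u v} → Boundary S e → Joins M e u v →
    ∃ λ y → vtx y ≡ v × edg y ≡ e × fac y ∈ S × fac (r2 y) ∉ S
  boundary-flag-at {S} (z , refl , z∈S , r2z∉S) joins with Primal.link-ends joins (z , refl , refl , refl)
  ... | inj₁ (_ , refl) =
        r0 z , refl , edg-r0 z , subst (_∈ S) (sym (fac-r0 z)) z∈S , subst (_∉ S) (sym fac-r2r0z) r2z∉S
    where
    fac-r2r0z : fac (r2 (r0 z)) ≡ fac (r2 z)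
    fac-r2r0z = trans (cong fac (sym (r02-comm z))) (fac-r0 (r2 z))
  ... | inj₂ (_ , refl) = z , refl , refl , z∈S , r2z∉S

  -- The flags at vtx y on faces in S are paired by r1, and all of them but y also by r2.
  boundary-flag-not-alone : (S : Subset nF) (y : Fin N) → fac y ∈ S → fac (r2 y) ∉ S →
    ¬ (∀ {z} → z ≢ y → vtx z ≡ vtx y → fac z ∈ S → fac (r2 z) ∈ S)
  boundary-flag-not-alone S y y∈S r2y∉S others =
    let k , ∣A∣≡2k   = σ-closed⇒∣p∣-even r1-inv r1-fpf A-r1-closed
        l , ∣A-y∣≡2l = σ-closed⇒∣p∣-even r2-inv r2-fpf A-y-r2-closed
    in even≢odd k l (begin
      2 * k         ≡⟨ sym ∣A∣≡2k ⟩
      ∣ A ∣         ≡⟨ ∣p∣≡1+∣p-x∣ (∈-toSubset⁺ at-y? (refl , y∈S)) ⟩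
      suc ∣ A - y ∣ ≡⟨ cong suc ∣A-y∣≡2l ⟩
      suc (2 * l)   ∎)
    where
    open ≡-Reasoning
    at-y? : ∀ z → Dec (vtx z ≡ vtx y × fac z ∈ S)
    at-y? z = vtx z ≟ vtx y ×-dec fac z ∈? S

    A : Subset N
    A = toSubset at-y?

    A-r1-closed : ∀ {z} → z ∈ A → r1 z ∈ A
    A-r1-closed z∈A with ∈-toSubset⁻ at-y? z∈A
    ... | at-y , z∈S = ∈-toSubset⁺ at-y? (trans (vtx-r1 _) at-y , subst (_∈ S) (sym (fac-r1 _)) z∈S)

    A-y-r2-closed : ∀ {z} → z ∈ A - y → r2 z ∈ A - y
    A-y-r2-closed {z} z∈A-y with ∈-toSubset⁻ at-y? (p─q⊆p _ _ z∈A-y)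
    ... | at-y , z∈S = x∈p∧x≢y⇒x∈p-y
          (∈-toSubset⁺ at-y? (trans (vtx-r2 z) at-y , others (x∈p-y⇒x≢y z∈A-y) at-y z∈S))
          λ { refl → r2y∉S (subst (_∈ S) (cong fac (sym (r2-inv z))) z∈S) }

module Walks (M : Map) where
  open Map M
  open MapProperties M using (module Primal)
  open import Data.Nat using (suc; _≤_; s≤s; z≤n)
  open import Data.Fin using (zero; suc; inject₁; fromℕ)
  open import Data.Fin.Properties using (_≟_; any?; fromℕ≢inject₁; inject₁-injective)
  open import Data.Fin.Subset using (_-_)
  open import Data.Fin.Subset.Properties using (p─q⊆p)
  open import Data.Empty using (⊥; ⊥-elim)
  open import Data.Sum using (inj₁; inj₂)
  open import Function.Definitions using (Injective)
  open import Relation.Nullary using (yes; no)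
  open import Relation.Binary.PropositionalEquality using (_≢_; refl; sym; trans; cong; subst)

  private variable
    S : Subset nE
    u v w : Fin nV

  _++_ : Walk M S u v → Walk M S v w → Walk M S u w
  stop ++ q = q
  move e e∈S joins p ++ q = move e e∈S joins (p ++ q)

  reverse : Walk M S u w → Walk M S w u
  reverse stop = stop
  reverse (move e e∈S joins p) = reverse p ++ move e e∈S (Primal.link-undirected joins) stop

  length : Walk M S u w → ℕ
  length stop = 0
  length (move _ _ _ p) = suc (length p)

  vertexAt : (p : Walk M S u w) → Fin (suc (length p)) → Fin nV
  vertexAt {u = u} stop zero = u
  vertexAt {u = u} (move _ _ _ p) zero = u
  vertexAt (move _ _ _ p) (suc i) = vertexAt p i

  edgeAt : (p : Walk M S u w) → Fin (length p) → Fin nE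
  edgeAt (move e _ _ p) zero = e
  edgeAt (move _ _ _ p) (suc i) = edgeAt p i

  vertexAt-first : (p : Walk M S u w) → vertexAt p zero ≡ u
  vertexAt-first stop = refl
  vertexAt-first (move _ _ _ p) = refl

  vertexAt-last : (p : Walk M S u w) → vertexAt p (fromℕ (length p)) ≡ w
  vertexAt-last stop = refl
  vertexAt-last (move _ _ _ p) = vertexAt-last p

  edgeAt-∈ : (p : Walk M S u w) → ∀ i → edgeAt p i ∈ S
  edgeAt-∈ (move _ e∈S _ p) zero = e∈S
  edgeAt-∈ (move _ _ _ p) (suc i) = edgeAt-∈ p i

  edgeAt-joins : (p : Walk M S u w) → ∀ i → Joins M (edgeAt p i) (vertexAt p (inject₁ i)) (vertexAt p (suc i))
  edgeAt-joins (move e _ joins p) zero = subst (Joins M e _) (sym (vertexAt-first p)) joins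
  edgeAt-joins (move _ _ _ p) (suc i) = edgeAt-joins p i

  data IsPath {S : Subset nE} : ∀ {u w} → Walk M S u w → Set where
    stop : IsPath (stop {u = u})
    move : ∀ {e e∈S joins} {p : Walk M S v w} →
      (∀ i → vertexAt p i ≢ u) → IsPath p → IsPath (move {u = u} e e∈S joins p)

  suffix : (p : Walk M S u w) → IsPath p → ∀ i → Σ (Walk M S (vertexAt p i) w) IsPath
  suffix stop path zero = stop , path
  suffix (move e e∈S joins p) path zero = move e e∈S joins p , path
  suffix (move _ _ _ p) (move _ path) (suc i) = suffix p path i

  toPath : Walk M S u w → Σ (Walk M S u w) IsPath
  toPath stop = stop , stop
  toPath {u = u} (move e e∈S joins p) with toPath p
  ... | q , q-path with any? (λ i → vertexAt q i ≟ u)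
  ...   | yes (i , refl) = suffix q q-path i
  ...   | no u∉q = move e e∈S joins q , move (λ i u≡ → u∉q (i , u≡)) q-path

  path-vertices-injective : {p : Walk M S u w} → IsPath p → Injective _≡_ _≡_ (vertexAt p)
  path-vertices-injective stop {zero} {zero} _ = refl
  path-vertices-injective (move _ _) {zero} {zero} _ = refl
  path-vertices-injective (move u∉p _) {zero} {suc j} u≡ = ⊥-elim (u∉p j (sym u≡))
  path-vertices-injective (move u∉p _) {suc i} {zero} ≡u = ⊥-elim (u∉p i ≡u)
  path-vertices-injective (move _ path) {suc i} {suc j} same = cong suc (path-vertices-injective path same)

  first-edge-not-repeated : ∀ {e} {p : Walk M S v w} → (∀ i → vertexAt p i ≢ u) → Joins M e u v →
    ∀ {i} → Joins M e (vertexAt p (inject₁ i)) (vertexAt p (suc i)) → ⊥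
  first-edge-not-repeated u∉p joins {i} joins′ with Primal.link-ends joins joins′
  ... | inj₁ (u≡ , _) = u∉p (inject₁ i) (sym u≡)
  ... | inj₂ (u≡ , _) = u∉p (suc i) (sym u≡)

  path-edges-injective : {p : Walk M S u w} → IsPath p → Injective _≡_ _≡_ (edgeAt p)
  path-edges-injective (move _ _) {zero} {zero} _ = refl
  path-edges-injective (move {joins = joins} {p = p} u∉p _) {zero} {suc j} same =
    ⊥-elim (first-edge-not-repeated u∉p joins (subst (λ e → Joins M e _ _) (sym same) (edgeAt-joins p j)))
  path-edges-injective (move {joins = joins} {p = p} u∉p _) {suc i} {zero} same =
    ⊥-elim (first-edge-not-repeated u∉p joins (subst (λ e → Joins M e _ _) same (edgeAt-joins p i)))
  path-edges-injective (move _ path) {suc i} {suc j} same = cong suc (path-edges-injective path same)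

  path-and-edge⇒cycle : Simple M → ∀ {T e u w} → e ∈ T → Joins M e u w →
    (q : Walk M (T - e) w u) → IsPath q → Cycle M T
  path-and-edge⇒cycle (loopless , no-parallel) {T} {e} {u} {w} e∈T joins q q-path =
    suc (length q) , 3≤length q joins , vs , es , sym (vertexAt-last q) , vs-injective , es-injective , es-ok
    where
    vs : Fin (suc (suc (length q))) → Fin nV
    vs zero = u
    vs (suc i) = vertexAt q i

    es : Fin (suc (length q)) → Fin nE
    es zero = e
    es (suc i) = edgeAt q i

    3≤length : ∀ {w} (q : Walk M (T - e) w u) → Joins M e u w → 3 ≤ suc (length q)
    3≤length stop (x , _ , x-at-u , r0x-at-u) = ⊥-elim (loopless x (trans x-at-u (sym r0x-at-u)))
    3≤length (move e′ e′∈T-e joins′ stop) joins =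
      ⊥-elim (x∈p-y⇒x≢y e′∈T-e (sym (no-parallel e e′ u _ joins (Primal.link-undirected joins′))))
    3≤length (move _ _ _ (move _ _ _ _)) _ = s≤s (s≤s (s≤s z≤n))

    vs-injective : Injective _≡_ _≡_ (λ i → vs (inject₁ i))
    vs-injective {zero} {zero} _ = refl
    vs-injective {zero} {suc j} u≡ =
      ⊥-elim (fromℕ≢inject₁ (path-vertices-injective q-path (trans (vertexAt-last q) u≡)))
    vs-injective {suc i} {zero} ≡u =
      ⊥-elim (fromℕ≢inject₁ (path-vertices-injective q-path (trans (vertexAt-last q) (sym ≡u))))
    vs-injective {suc i} {suc j} same = cong suc (inject₁-injective (path-vertices-injective q-path same))

    es-injective : Injective _≡_ _≡_ es
    es-injective {zero} {zero} _ = refl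
    es-injective {zero} {suc j} e≡ = ⊥-elim (x∈p-y⇒x≢y (edgeAt-∈ q j) (sym e≡))
    es-injective {suc i} {zero} ≡e = ⊥-elim (x∈p-y⇒x≢y (edgeAt-∈ q i) ≡e)
    es-injective {suc i} {suc j} same = cong suc (path-edges-injective q-path same)

    es-ok : ∀ i → es i ∈ T × Joins M (es i) (vs (inject₁ i)) (vs (suc i))
    es-ok zero = e∈T , subst (Joins M e u) (sym (vertexAt-first q)) joins
    es-ok (suc i) = p─q⊆p _ _ (edgeAt-∈ q i) , edgeAt-joins q i

module SpanningTrees (M : Map) (simple : Simple M) {T : Subset (Map.nE M)} (spanning : SpanningTree M T) where
  open Map M
  open MapProperties M
  open Walks M
  open Graph (Joins M) using (Connected; Arborescence; spanning-arborescence)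
  open import Data.Nat using (suc)
  open import Data.Nat.Properties using (≤-antisym)
  open import Data.Fin.Subset using (_-_; ∁)
  open import Data.Fin.Subset.Properties using (_∈?_; x∈p∧x≢y⇒x∈p-y; x∉p⇒x∈∁p)
  open import Data.Empty using (⊥-elim)
  open import Data.Product using (proj₁; proj₂)
  open import Data.Sum using (inj₁; inj₂)
  open import Relation.Nullary using (yes; no; ¬_)
  open import Relation.Binary.PropositionalEquality using (_≢_; refl; sym; trans; subst)

  root : Fin nV
  root = vtx nonempty

  T-connected : Connected T root
  T-connected {X} closed root∈X v = along (proj₁ spanning root v) root∈X
    where
    along : ∀ {u w} → Walk M T u w → u ∈ X → w ∈ X
    along stop u∈X = u∈X
    along (move e e∈T joins p) u∈X = along p (closed e∈T joins u∈X)

  tree : Arborescence T root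
  tree = spanning-arborescence Primal.link? T-connected

  open Arborescence tree

  -- Otherwise the tree paths from the ends of e to the root avoid e and close a cycle with it.
  tree-edges-are-up-edges : ∀ {e} → e ∈ T → IsUpEdge e
  tree-edges-are-up-edges {e} e∈T with isUpEdge? e
  ... | yes up-edge = up-edge
  ... | no not-up-edge =
        ⊥-elim (proj₂ spanning (path-and-edge⇒cycle simple e∈T joins (proj₁ path) (proj₂ path)))
    where
    x = proj₁ (edg-surj e)
    joins : Joins M e (vtx x) (vtx (r0 x))
    joins = x , proj₂ (edg-surj e) , refl , refl

    to-root : ∀ v → Walk M (T - e) v root
    to-root = induction (λ v → Walk M (T - e) v root) stop λ {v} v≢r rest →
      move (upEdge v v≢r)
           (x∈p∧x≢y⇒x∈p-y (upEdge∈K v≢r) λ up≡e → not-up-edge (v , v≢r , up≡e))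
           (Primal.link-undirected (upEdge-adjacent v≢r))
           rest

    path = toPath (to-root (vtx (r0 x)) ++ reverse (to-root (vtx x)))

  1+∣T∣≡nV : suc ∣ T ∣ ≡ nV
  1+∣T∣≡nV = ≤-antisym (up-edges-onto⇒∣K∣<n tree-edges-are-up-edges) (n≤1+∣K∣ Primal.link-ends)

  module _ {S : Subset nF} (closed : Graph.Closed DualJoins (∁ T) S) where

    boundary⊆T : ∀ {e} → Boundary S e → e ∈ T
    boundary⊆T (z , refl , z∈S , r2z∉S) with edg z ∈? T
    ... | yes e∈T = e∈T
    ... | no e∉T = ⊥-elim (r2z∉S (closed (x∉p⇒x∈∁p e∉T) (z , refl , refl , refl) z∈S))

    others-inside : ∀ {y} → (∀ {e w} → Boundary S e → Joins M e (vtx y) w → e ≡ edg y) → fac (r2 y) ∉ S →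
      ∀ {z} → z ≢ y → vtx z ≡ vtx y → fac z ∈ S → fac (r2 z) ∈ S
    others-inside {y} only r2y∉S {z} z≢y z-at-y z∈S with fac (r2 z) ∈? S
    ... | yes r2z∈S = r2z∈S
    ... | no r2z∉S with same-vertex-and-edge (proj₁ simple)
                          (sym (only (z , refl , z∈S , r2z∉S) (z , refl , z-at-y , refl))) z-at-y
    ...   | inj₁ z≡y = ⊥-elim (z≢y z≡y)
    ...   | inj₂ refl = ⊥-elim (r2y∉S z∈S)

    no-boundary : ∀ {e} → ¬ Boundary S e
    no-boundary b with leaf Primal.link-ends tree-edges-are-up-edges (boundary? S) boundary⊆T b
    ... | v , v≢r , up-edge-on-boundary , only with boundary-flag-at up-edge-on-boundary (upEdge-adjacent v≢r)
    ...   | y , refl , y-edge , y∈S , r2y∉S = boundary-flag-not-alone S y y∈S r2y∉S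
            (others-inside (λ b′ joins → trans (only b′ joins) (sym y-edge)) r2y∉S)

  cotree-connected : ∀ f → Graph.Connected DualJoins (∁ T) f
  cotree-connected f {S} closed f∈S g with g ∈? S
  ... | yes g∈S = g∈S
  ... | no g∉S =
    let z , z∈S , r2z∉S = crossing S (connected x y) x∈S y∉S
    in ⊥-elim (no-boundary closed (z , refl , z∈S , r2z∉S))
    where
    x = proj₁ (fac-surj f)
    y = proj₁ (fac-surj g)
    x∈S = subst (_∈ S) (sym (proj₂ (fac-surj f))) f∈S
    y∉S = λ y∈S → g∉S (subst (_∈ S) (proj₂ (fac-surj g)) y∈S)

module HedgeCounting (M : Map) where
  open Map M
  open import Data.Nat using (_+_; _≤_)
  open import Data.Nat.Properties using (≤-antisym)
  open import Data.Fin.Properties using (_≟_; any?)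
  open import Data.Fin.Subset using (∁; ⊤)
  open import Data.Fin.Subset.Properties using (∈⊤; ∣⊤∣≡n; x∈∁p⇒x∉p; x∉p⇒x∈∁p)
  open import Data.Product using (∃; _,_; proj₁; proj₂)
  open import Function.Definitions using (Injective)
  open import Relation.Nullary using (¬_)
  open import Relation.Nullary.Decidable using (¬?; decidable-stable)
  open import Relation.Binary.PropositionalEquality using (refl; sym; trans; cong; subst; module ≡-Reasoning)

  module _ {τ : Fin nF → Fin nE} where

    ∈Hedges⁺ : ∀ {e} → ¬ (∃ λ f → τ f ≡ e) → e ∈ Hedges M τ
    ∈Hedges⁺ = ∈-toSubset⁺ (λ e → ¬? (any? λ f → τ f ≟ e))

    ∈Hedges⁻ : ∀ {e} → e ∈ Hedges M τ → ¬ (∃ λ f → τ f ≡ e)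
    ∈Hedges⁻ = ∈-toSubset⁻ (λ e → ¬? (any? λ f → τ f ≟ e))

    avoiding⇒⊆Hedges : ∀ {T} → (∀ f → τ f ∉ T) → ∀ e → e ∈ T → e ∈ Hedges M τ
    avoiding⇒⊆Hedges {T} avoids e e∈T =
      ∈Hedges⁺ λ (f , τf≡e) → avoids f (subst (_∈ T) (sym τf≡e) e∈T)

    ∣Hedges∣+nF≡nE : Injective _≡_ _≡_ τ → ∣ Hedges M τ ∣ + nF ≡ nE
    ∣Hedges∣+nF≡nE τ-injective = begin
      ∣ Hedges M τ ∣ + nF             ≡⟨ cong (∣ Hedges M τ ∣ +_) (sym ∣∁Hedges∣≡nF) ⟩
      ∣ Hedges M τ ∣ + ∣ ∁ (Hedges M τ) ∣ ≡⟨ ∣p∣+∣∁p∣≡n (Hedges M τ) ⟩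
      nE                             ∎
      where
      open ≡-Reasoning
      preimage : ∀ {e} → e ∈ ∁ (Hedges M τ) → ∃ λ f → τ f ≡ e
      preimage {e} e∈∁H =
        decidable-stable (any? λ f → τ f ≟ e) λ none → x∈∁p⇒x∉p e∈∁H (∈Hedges⁺ none)

      ∣∁Hedges∣≡nF : ∣ ∁ (Hedges M τ) ∣ ≡ nF
      ∣∁Hedges∣≡nF = ≤-antisym
        (subst (∣ ∁ (Hedges M τ) ∣ ≤_) (∣⊤∣≡n nF)
          (injection⇒∣p∣≤∣q∣ (λ e∈ → proj₁ (preimage e∈)) (λ _ → ∈⊤) λ e∈ e′∈ same →
             trans (sym (proj₂ (preimage e∈))) (trans (cong τ same) (proj₂ (preimage e′∈)))))
        (subst (_≤ ∣ ∁ (Hedges M τ) ∣) (∣⊤∣≡n nF)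
          (injection⇒∣p∣≤∣q∣ {p = ⊤} (λ {f} _ → τ f)
             (λ {f} _ → x∉p⇒x∈∁p λ τf∈H → ∈Hedges⁻ τf∈H (f , refl))
             λ _ _ → τ-injective))

module EdgeAssignments (M : Map) (simple : Simple M) {T : Subset (Map.nE M)} (spanning : SpanningTree M T) where
  open Map M
  open MapProperties M
  open SpanningTrees M simple spanning using (cotree-connected)
  open Graph DualJoins using (Arborescence; spanning-arborescence)
  open import Data.Nat using (_≤_)
  open import Data.Nat.Properties using (<⇒≱)
  open import Data.Fin.Properties using (any?)
  open import Data.Fin.Subset using (∁; _-_)
  open import Data.Fin.Subset.Properties using (_∈?_; x∈p∧x≢y⇒x∈p-y; x∈∁p⇒x∉p; p─q⊆p)
  open import Data.Empty using (⊥-elim)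
  open import Data.Product using (∃; proj₁; proj₂)
  open import Data.Sum using (_⊎_; inj₁; inj₂)
  open import Relation.Nullary using (yes; no; ¬_)
  open import Relation.Nullary.Decidable using (_×-dec_; ¬?; decidable-stable)
  open import Relation.Binary.PropositionalEquality using (refl)

  -- Abstract, so that the type checker never unfolds the construction of the tree.
  abstract
    face-tree : Arborescence (∁ T) (fac nonempty)
    face-tree = spanning-arborescence Dual.link? (cotree-connected _)

  open Arborescence face-tree using (IsUpEdge; isUpEdge?; upEdge; upEdge∈K; up-edges-onto⇒∣K∣<n; narrow)

  cotree-edge-off-face-tree : nF ≤ ∣ ∁ T ∣ → ∃ λ e₀ → e₀ ∈ ∁ T × ¬ IsUpEdge e₀
  cotree-edge-off-face-tree large with any? (λ e → e ∈? ∁ T ×-dec ¬? (isUpEdge? e))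
  ... | yes found = found
  ... | no none = ⊥-elim (<⇒≱ (up-edges-onto⇒∣K∣<n all-up-edges) large)
    where
    all-up-edges : ∀ {e} → e ∈ ∁ T → IsUpEdge e
    all-up-edges {e} e∈∁T = decidable-stable (isUpEdge? e) λ not-up-edge → none (e , e∈∁T , not-up-edge)

  edge-assignment-avoiding : nF ≤ ∣ ∁ T ∣ → Σ (Fin nF → Fin nE) λ τ → EdgeAssignment M τ × (∀ f → τ f ∉ T)
  edge-assignment-avoiding large =
    let τ , τ-injective , τ-incident , τ-new-or-tree =
          Arborescence.assignment rerooted Dual.link-ends (λ e₀∈ → x∈p-y⇒x≢y e₀∈ refl)
            (_ , Dual.link-undirected (x₀ , proj₂ (edg-surj e₀) , refl , refl))
    in τ , (τ-injective , λ f → dual-incident⇒on-face (τ-incident f)) , λ f → outside-T (τ-new-or-tree f)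
    where
    extra = cotree-edge-off-face-tree large
    e₀ = proj₁ extra
    x₀ = proj₁ (edg-surj e₀)

    face-tree-avoids-e₀ : ∀ {f} f≢r → upEdge f f≢r ∈ ∁ T - e₀
    face-tree-avoids-e₀ {f} f≢r =
      x∈p∧x≢y⇒x∈p-y (upEdge∈K f≢r) λ up≡e₀ → proj₂ (proj₂ extra) (f , f≢r , up≡e₀)

    rerooted : Arborescence (∁ T - e₀) (fac x₀)
    rerooted = spanning-arborescence Dual.link?
      (Arborescence.connects (narrow face-tree-avoids-e₀) Dual.link-undirected (fac x₀))

    outside-T : ∀ {e} → e ≡ e₀ ⊎ e ∈ ∁ T - e₀ → e ∉ T
    outside-T (inj₁ refl) = x∈∁p⇒x∉p (proj₁ (proj₂ extra))
    outside-T (inj₂ e∈) = x∈∁p⇒x∉p (p─q⊆p _ _ e∈)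

module EulerArithmetic where
  import Data.Nat as ℕ
  open import Data.Nat.Properties using (≤-pred; +-cancelˡ-≤)
  open import Data.Integer using (+_; _-_; _+_; _≤_; 1ℤ)
  open import Data.Integer.Properties using (pos-+; +-monoˡ-≤; drop‿+≤+)
  open import Data.Integer.Solver using (module +-*-Solver)
  open import Relation.Binary.PropositionalEquality using (refl; sym; cong₂; subst; module ≡-Reasoning)
  open +-*-Solver

  χ≤1⇒faces≤cotree : ∀ {t c v e f} → t ℕ.+ c ≡ e → ℕ.suc t ≡ v → + v - + e + + f ≤ 1ℤ → f ℕ.≤ c
  χ≤1⇒faces≤cotree {t} {c} {f = f} refl refl χ≤1 =
    +-cancelˡ-≤ t f c (≤-pred (drop‿+≤+
      (subst (_≤ + ℕ.suc (t ℕ.+ c)) χ+e≡v+f (+-monoˡ-≤ (+ (t ℕ.+ c)) χ≤1))))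
    where
    χ+e≡v+f : + ℕ.suc t - + (t ℕ.+ c) + + f + + (t ℕ.+ c) ≡ + (ℕ.suc t ℕ.+ f)
    χ+e≡v+f = solve 3 (λ v e f → v :- e :+ f :+ e := v :+ f) refl (+ ℕ.suc t) (+ (t ℕ.+ c)) (+ f)

  Hedges-size : ∀ {h t v e f} → h ℕ.+ f ≡ e → ℕ.suc t ≡ v → + h ≡ + t - (+ v - + e + + f) + 1ℤ
  Hedges-size {h} {t} {f = f} refl refl = begin
    + h
      ≡⟨ solve 3 (λ h t f → h := t :- ((con 1ℤ :+ t) :- (h :+ f) :+ f) :+ con 1ℤ) refl (+ h) (+ t) (+ f) ⟩
    + t - ((1ℤ + + t) - (+ h + + f) + + f) + 1ℤ
      ≡⟨ cong₂ (λ v e → + t - (v - e + + f) + 1ℤ) (sym (pos-+ 1 t)) (sym (pos-+ h f)) ⟩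
    + t - (+ ℕ.suc t - + (h ℕ.+ f) + + f) + 1ℤ
      ∎
    where open ≡-Reasoning

open import Data.Integer using (+_; _-_; _+_; _≤_; 1ℤ)

lemma2 : (M : Map) → Simple M → Polyhedral M → χ M ≤ 1ℤ →
    (T : Subset (Map.nE M)) → SpanningTree M T →
      (Σ (Fin (Map.nF M) → Fin (Map.nE M)) λ τ →
          EdgeAssignment M τ × (∀ f → τ f ∉ T))
    × ((τ : Fin (Map.nF M) → Fin (Map.nE M)) → EdgeAssignment M τ → (∀ f → τ f ∉ T) →
          (∀ e → e ∈ T → e ∈ Hedges M τ)
        × (+ ∣ Hedges M τ ∣ ≡ + ∣ T ∣ - χ M + 1ℤ))
lemma2 M simple _ χ≤1 T spanning =
    edge-assignment-avoiding (χ≤1⇒faces≤cotree (∣p∣+∣∁p∣≡n T) 1+∣T∣≡nV χ≤1)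
  , λ τ (τ-injective , _) avoids →
      avoiding⇒⊆Hedges avoids , Hedges-size (∣Hedges∣+nF≡nE τ-injective) 1+∣T∣≡nV
  where
  open SpanningTrees M simple spanning using (1+∣T∣≡nV)
  open EdgeAssignments M simple spanning using (edge-assignment-avoiding)
  open HedgeCounting M using (avoiding⇒⊆Hedges; ∣Hedges∣+nF≡nE)
  open EulerArithmetic
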